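{- Let $j$ be a positive integer and $C(n)=\sum_{i=0}^{j-1}\left\lceil \frac{n-i}{2j}\right\rceil$ for $n\in\mathbb{Z}$. Let $s_1,a_1,s_2,a_2$ be integers such that $C(n)=C(n-s_1-C(n-a_1))+C(n-s_2-C(n-a_2))$ for all $n\in\mathbb{Z}$. Then (i) $s_1\equiv s_2\equiv 0\pmod j$; (ii) $a_1\equiv a_2\equiv j\pmod{2j}$; (iii) $2(s_1+s_2)=a_1+a_2$. -}

module Defs where

open import Data.Nat as ℕ using (ℕ; NonZero)
open import Data.Nat.Properties using (m*n≢0)
open import Data.Integer using (ℤ; +_; -_; _+_; _-_; _/ℕ_; 0ℤ)
open import Data.List using (List; map; foldr; upTo)

⌈_/ℕ_⌉ : ℤ → (d : ℕ) → .{{NonZero d}} → ℤ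
⌈ m /ℕ d ⌉ = - ((- m) /ℕ d)

sumℤ : List ℤ → ℤ
sumℤ = foldr _+_ 0ℤ

C : (j : ℕ) → .{{NonZero j}} → ℤ → ℤ
C j n = sumℤ (map (λ i → ⌈ (n - + i) /ℕ (2 ℕ.* j) ⌉ {{m*n≢0 2 j}}) (upTo j))

-- Writing n = 2jq + r with 0 ≤ r < 2j, the terms of C(n) are q + 1 for i < r and q otherwise, so
-- C(n) = jq + min(r, j). Hence C(n + 2j) = C(n) + j, C(n + j) + C(n) = n + j, and
-- 2C(n) = n + e(n), where the excess e(n) = min(r, 2j − r) ∈ [0, j] is the distance from n to 2jℤ.
-- Adding the recurrence at n and at n + 2j and using these identities gives
--   e(n − a₁) + e(n − a₂) = (a₁ + a₂ − 2(s₁ + s₂)) + 2j + 2n − 4C(n),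
-- and comparing n = 0 with n = j forces e(−a₁) = e(−a₂) = j, which is (ii), and then (iii).
-- By (ii) the inner arguments n − sᵢ − C(n − aᵢ) simplify to C(n) + uᵢ for constants uᵢ;
-- evaluating the recurrence where C(n) = −u₁ gives C(u₂ − u₁) = −u₁, so e(u₂ − u₁) = j,
-- which determines u₁ and u₂ as multiples of j and gives (i).
module Submission where

open import Defs
open import Data.Nat as ℕ using (ℕ; NonZero; zero; suc)
import Data.Nat.Properties as ℕₚ
open import Data.Integer
  using (ℤ; +_; -_; _+_; _-_; _*_; _/ℕ_; _%ℕ_; 0ℤ; 1ℤ; _≤_; _<_; +<+)
  renaming (suc to sucℤ)
open import Data.Integer.Properties
open import Data.Integer.DivMod using (a≡a%ℕn+[a/ℕn]*n; n%ℕd<d; [n/ℕd]*d≤n; n<s[n/ℕd]*d)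
open import Data.Integer.Divisibility using (_∣_)
open import Data.Integer.Divisibility.Signed using (divides; ∣⇒∣ᵤ)
open import Data.Integer.Tactic.RingSolver using (solve-∀)
open import Data.List using ([]; _∷_; _∷ʳ_; [_]; map; upTo)
open import Data.List.Properties using (upTo-∷ʳ; map-++)
open import Data.Product using (_×_; _,_; ∃; proj₁; proj₂)
open import Data.Empty using (⊥)
open import Function using (_∘_)
open import Relation.Binary.PropositionalEquality using (_≡_; refl; sym; trans; cong; cong₂; subst; module ≡-Reasoning)
open import Relation.Nullary using (yes; no)
open ≡-Reasoning

2*n≡n+n : ∀ n → 2 ℕ.* n ≡ n ℕ.+ n
2*n≡n+n n = cong (n ℕ.+_) (ℕₚ.+-identityʳ n)

n≤m⇒2*n∸m≤n : ∀ {m n} → n ℕ.≤ m → 2 ℕ.* n ℕ.∸ m ℕ.≤ n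
n≤m⇒2*n∸m≤n {m} {n} n≤m = subst (2 ℕ.* n ℕ.∸ m ℕ.≤_) 2*n∸n≡n (ℕₚ.∸-monoʳ-≤ (2 ℕ.* n) n≤m)
  where
  2*n∸n≡n : 2 ℕ.* n ℕ.∸ n ≡ n
  2*n∸n≡n = trans (ℕₚ.m+n∸m≡n n (n ℕ.+ 0)) (ℕₚ.+-identityʳ n)

m⊓[2*n∸m]≤n : ∀ m n → m ℕ.⊓ (2 ℕ.* n ℕ.∸ m) ℕ.≤ n
m⊓[2*n∸m]≤n m n with m ℕₚ.≤? n
... | yes m≤n = ℕₚ.≤-trans (ℕₚ.m⊓n≤m m _) m≤n
... | no  m≰n = ℕₚ.≤-trans (ℕₚ.m⊓n≤n m _) (n≤m⇒2*n∸m≤n (ℕₚ.<⇒≤ (ℕₚ.≰⇒> m≰n)))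

m⊓[2*n∸m]≡n⇒m≡n : ∀ {m n} → m ℕ.≤ 2 ℕ.* n → m ℕ.⊓ (2 ℕ.* n ℕ.∸ m) ≡ n → m ≡ n
m⊓[2*n∸m]≡n⇒m≡n {m} {n} m≤2n eq = ℕₚ.≤-antisym m≤n n≤m
  where
  n≤m : n ℕ.≤ m
  n≤m = subst (ℕ._≤ m) eq (ℕₚ.m⊓n≤m m _)
  n+m≤n+n : n ℕ.+ m ℕ.≤ n ℕ.+ n
  n+m≤n+n = subst (n ℕ.+ m ℕ.≤_) (2*n≡n+n n)
    (ℕₚ.m≤o∸n⇒m+n≤o n m≤2n (subst (ℕ._≤ 2 ℕ.* n ℕ.∸ m) eq (ℕₚ.m⊓n≤n m _)))
  m≤n : m ℕ.≤ n
  m≤n = ℕₚ.+-cancelˡ-≤ n m n n+m≤n+n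

m⊓n+m⊓n≡m+m⊓[2*n∸m] : ∀ {m n} → m ℕ.≤ 2 ℕ.* n →
  m ℕ.⊓ n ℕ.+ m ℕ.⊓ n ≡ m ℕ.+ m ℕ.⊓ (2 ℕ.* n ℕ.∸ m)
m⊓n+m⊓n≡m+m⊓[2*n∸m] {m} {n} m≤2n with m ℕₚ.≤? n
... | yes m≤n = begin
  m ℕ.⊓ n ℕ.+ m ℕ.⊓ n                 ≡⟨ cong (λ x → x ℕ.+ x) (ℕₚ.m≤n⇒m⊓n≡m m≤n) ⟩
  m ℕ.+ m                             ≡⟨ cong (m ℕ.+_) (ℕₚ.m≤n⇒m⊓n≡m m≤2n∸m) ⟨
  m ℕ.+ m ℕ.⊓ (2 ℕ.* n ℕ.∸ m)         ∎
  where
  m≤2n∸m : m ℕ.≤ 2 ℕ.* n ℕ.∸ m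
  m≤2n∸m = ℕₚ.m+n≤o⇒m≤o∸n m (subst (m ℕ.+ m ℕ.≤_) (sym (2*n≡n+n n)) (ℕₚ.+-mono-≤ m≤n m≤n))
... | no m≰n = begin
  m ℕ.⊓ n ℕ.+ m ℕ.⊓ n                 ≡⟨ cong (λ x → x ℕ.+ x) (ℕₚ.m≥n⇒m⊓n≡n n≤m) ⟩
  n ℕ.+ n                             ≡⟨ 2*n≡n+n n ⟨
  2 ℕ.* n                             ≡⟨ ℕₚ.m+[n∸m]≡n m≤2n ⟨
  m ℕ.+ (2 ℕ.* n ℕ.∸ m)               ≡⟨ cong (m ℕ.+_) (ℕₚ.m≥n⇒m⊓n≡n (ℕₚ.≤-trans (n≤m⇒2*n∸m≤n n≤m) n≤m)) ⟨
  m ℕ.+ m ℕ.⊓ (2 ℕ.* n ℕ.∸ m)         ∎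
  where
  n≤m : n ℕ.≤ m
  n≤m = ℕₚ.<⇒≤ (ℕₚ.≰⇒> m≰n)

m≤o⇒n≤o⇒2*o≤m+n⇒m≡o×n≡o : ∀ {m n o} → m ℕ.≤ o → n ℕ.≤ o → 2 ℕ.* o ℕ.≤ m ℕ.+ n → m ≡ o × n ≡ o
m≤o⇒n≤o⇒2*o≤m+n⇒m≡o×n≡o {m} {n} {o} m≤o n≤o 2o≤m+n =
  ℕₚ.≤-antisym m≤o (ℕₚ.≮⇒≥ λ m<o → not-below (ℕₚ.+-mono-<-≤ m<o n≤o)) ,
  ℕₚ.≤-antisym n≤o (ℕₚ.≮⇒≥ λ n<o → not-below (ℕₚ.+-mono-≤-< m≤o n<o))
  where
  not-below : m ℕ.+ n ℕ.< o ℕ.+ o → ⊥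
  not-below lt = ℕₚ.<⇒≱ lt (subst (ℕ._≤ m ℕ.+ n) (2*n≡n+n o) 2o≤m+n)

+[m∸n]≡+m-+n : ∀ {m n} → n ℕ.≤ m → + (m ℕ.∸ n) ≡ + m - + n
+[m∸n]≡+m-+n {m} {n} n≤m = sym (trans (m-n≡m⊖n m n) (⊖-≥ n≤m))

sumℤ-∷ʳ : ∀ xs x → sumℤ (xs ∷ʳ x) ≡ sumℤ xs + x
sumℤ-∷ʳ []       x = +-comm x 0ℤ
sumℤ-∷ʳ (y ∷ xs) x = trans (cong (_+_ y) (sumℤ-∷ʳ xs x)) (sym (+-assoc y (sumℤ xs) x))

sumℤ-map-upTo-suc : ∀ (f : ℕ → ℤ) k → sumℤ (map f (upTo (suc k))) ≡ sumℤ (map f (upTo k)) + f k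
sumℤ-map-upTo-suc f k = begin
  sumℤ (map f (upTo (suc k)))   ≡⟨ cong (sumℤ ∘ map f) (upTo-∷ʳ k) ⟨
  sumℤ (map f (upTo k ∷ʳ k))    ≡⟨ cong sumℤ (map-++ f (upTo k) [ k ]) ⟩
  sumℤ (map f (upTo k) ∷ʳ f k)  ≡⟨ sumℤ-∷ʳ (map f (upTo k)) (f k) ⟩
  sumℤ (map f (upTo k)) + f k   ∎

module _ (d : ℕ) .{{_ : NonZero d}} where

  /ℕ-unique : ∀ {m} k → k * + d ≤ m → m < sucℤ k * + d → m /ℕ d ≡ k
  /ℕ-unique {m} k kd≤m m<[1+k]d = ≤-antisym
    (below (m /ℕ d) k ([n/ℕd]*d≤n m d) m<[1+k]d)
    (below k (m /ℕ d) kd≤m (n<s[n/ℕd]*d m d))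
    where
    below : ∀ a b → a * + d ≤ m → m < sucℤ b * + d → a ≤ b
    below a b ad≤m m<[1+b]d = ≮⇒≥ λ b<a →
      <⇒≱ m<[1+b]d (≤-trans (*-monoʳ-≤-nonNeg (+ d) (i<j⇒suc[i]≤j b<a)) ad≤m)

  [t+kd]/ℕd≡k : ∀ k {t} → t ℕ.< d → (+ t + k * + d) /ℕ d ≡ k
  [t+kd]/ℕd≡k k {t} t<d = /ℕ-unique k (i≤j+i (k * + d) (+ t))
    (subst (+ t + k * + d <_) (sym (suc-* k (+ d))) (+-monoˡ-< (k * + d) (+<+ t<d)))

  ⌈kd-t/ℕd⌉≡k : ∀ k {t} → t ℕ.< d → ⌈ k * + d - + t /ℕ d ⌉ ≡ k
  ⌈kd-t/ℕd⌉≡k k {t} t<d = begin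
    ⌈ k * + d - + t /ℕ d ⌉        ≡⟨⟩
    - ((- (k * + d - + t)) /ℕ d)  ≡⟨ cong (λ x → - (x /ℕ d)) (negate k (+ t) (+ d)) ⟩
    - ((+ t + (- k) * + d) /ℕ d)  ≡⟨ cong -_ ([t+kd]/ℕd≡k (- k) t<d) ⟩
    - - k                         ≡⟨ neg-involutive k ⟩
    k                             ∎
    where
    negate : ∀ k t d → - (k * d - t) ≡ t + (- k) * d
    negate = solve-∀

  ⌈r+qd-i/ℕd⌉≡q : ∀ q {r i} → r ℕ.≤ i → i ℕ.< d → ⌈ + r + q * + d - + i /ℕ d ⌉ ≡ q
  ⌈r+qd-i/ℕd⌉≡q q {r} {i} r≤i i<d = begin
    ⌈ + r + q * + d - + i /ℕ d ⌉           ≡⟨ cong (λ x → ⌈ x /ℕ d ⌉) (regroup (+ r) q (+ d) (+ i)) ⟩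
    ⌈ q * + d - (+ i - + r) /ℕ d ⌉         ≡⟨ cong (λ x → ⌈ q * + d - x /ℕ d ⌉) (+[m∸n]≡+m-+n r≤i) ⟨
    ⌈ q * + d - + (i ℕ.∸ r) /ℕ d ⌉         ≡⟨ ⌈kd-t/ℕd⌉≡k q (ℕₚ.≤-<-trans (ℕₚ.m∸n≤m i r) i<d) ⟩
    q                                      ∎
    where
    regroup : ∀ r q d i → r + q * d - i ≡ q * d - (i - r)
    regroup = solve-∀

  ⌈r+qd-i/ℕd⌉≡q+1 : ∀ q {r i} → i ℕ.< r → r ℕ.≤ d → ⌈ + r + q * + d - + i /ℕ d ⌉ ≡ q + 1ℤ
  ⌈r+qd-i/ℕd⌉≡q+1 q {r} {i} i<r r≤d = begin
    ⌈ + r + q * + d - + i /ℕ d ⌉                  ≡⟨ cong (λ x → ⌈ x /ℕ d ⌉) (regroup (+ r) q (+ d) (+ i)) ⟩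
    ⌈ (q + 1ℤ) * + d - (+ d - (+ r - + i)) /ℕ d ⌉ ≡⟨ cong (λ x → ⌈ (q + 1ℤ) * + d - x /ℕ d ⌉) t≡ ⟨
    ⌈ (q + 1ℤ) * + d - + t /ℕ d ⌉                 ≡⟨ ⌈kd-t/ℕd⌉≡k (q + 1ℤ) t<d ⟩
    q + 1ℤ                                        ∎
    where
    regroup : ∀ r q d i → r + q * d - i ≡ (q + 1ℤ) * d - (d - (r - i))
    regroup = solve-∀
    r∸i≤d : r ℕ.∸ i ℕ.≤ d
    r∸i≤d = ℕₚ.≤-trans (ℕₚ.m∸n≤m r i) r≤d
    t = d ℕ.∸ (r ℕ.∸ i)
    t<d : t ℕ.< d
    t<d = ℕₚ.∸-monoʳ-< (ℕₚ.m<n⇒0<n∸m i<r) r∸i≤d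
    t≡ : + t ≡ + d - (+ r - + i)
    t≡ = trans (+[m∸n]≡+m-+n r∸i≤d) (cong (_-_ (+ d)) (+[m∸n]≡+m-+n (ℕₚ.<⇒≤ i<r)))

  ceilSum : ℕ → ℤ → ℤ
  ceilSum k n = sumℤ (map (λ i → ⌈ (n - + i) /ℕ d ⌉) (upTo k))

  ceilSum-closed : ∀ q {r} k → r ℕ.< d → k ℕ.≤ d →
    ceilSum k (+ r + q * + d) ≡ + k * q + + (r ℕ.⊓ k)
  ceilSum-closed q {r} zero r<d _ = cong +_ (sym (ℕₚ.⊓-zeroʳ r))
  ceilSum-closed q {r} (suc k) r<d k<d = begin
    ceilSum (suc k) n                        ≡⟨ sumℤ-map-upTo-suc (λ i → ⌈ (n - + i) /ℕ d ⌉) k ⟩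
    ceilSum k n + ⌈ n - + k /ℕ d ⌉           ≡⟨ cong (_+ ⌈ n - + k /ℕ d ⌉) (ceilSum-closed q k r<d (ℕₚ.<⇒≤ k<d)) ⟩
    + k * q + + (r ℕ.⊓ k) + ⌈ n - + k /ℕ d ⌉ ≡⟨ next-term ⟩
    + suc k * q + + (r ℕ.⊓ suc k)            ∎
    where
    n = + r + q * + d
    next-term : + k * q + + (r ℕ.⊓ k) + ⌈ n - + k /ℕ d ⌉ ≡ + suc k * q + + (r ℕ.⊓ suc k)
    next-term with k ℕₚ.<? r
    ... | yes k<r = begin
      + k * q + + (r ℕ.⊓ k) + ⌈ n - + k /ℕ d ⌉ ≡⟨ cong₂ (λ m c → + k * q + + m + c)
                                                     (ℕₚ.m≥n⇒m⊓n≡n (ℕₚ.<⇒≤ k<r)) (⌈r+qd-i/ℕd⌉≡q+1 q k<r (ℕₚ.<⇒≤ r<d)) ⟩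
      + k * q + + k + (q + 1ℤ)                 ≡⟨ step (+ k) q ⟩
      (1ℤ + + k) * q + (1ℤ + + k)              ≡⟨ cong (λ x → x * q + x) (pos-+ 1 k) ⟨
      + suc k * q + + suc k                    ≡⟨ cong (λ m → + suc k * q + + m) (ℕₚ.m≥n⇒m⊓n≡n k<r) ⟨
      + suc k * q + + (r ℕ.⊓ suc k)            ∎
      where
      step : ∀ k q → k * q + k + (q + 1ℤ) ≡ (1ℤ + k) * q + (1ℤ + k)
      step = solve-∀
    ... | no k≮r = begin
      + k * q + + (r ℕ.⊓ k) + ⌈ n - + k /ℕ d ⌉ ≡⟨ cong₂ (λ m c → + k * q + + m + c)
                                                     (ℕₚ.m≤n⇒m⊓n≡m r≤k) (⌈r+qd-i/ℕd⌉≡q q r≤k k<d) ⟩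
      + k * q + + r + q                        ≡⟨ step (+ k) q (+ r) ⟩
      (1ℤ + + k) * q + + r                     ≡⟨ cong₂ (λ x m → x * q + + m) (pos-+ 1 k) (ℕₚ.m≤n⇒m⊓n≡m (ℕₚ.m≤n⇒m≤1+n r≤k)) ⟨
      + suc k * q + + (r ℕ.⊓ suc k)            ∎
      where
      r≤k : r ℕ.≤ k
      r≤k = ℕₚ.≮⇒≥ k≮r
      step : ∀ k q r → k * q + r + q ≡ (1ℤ + k) * q + r
      step = solve-∀

module C-Properties (j : ℕ) .{{_ : NonZero j}} where

  J P : ℤ
  J = + j
  P = + 2 * J

  D : ℕ
  D = 2 ℕ.* j

  instance
    D≢0 : NonZero D
    D≢0 = ℕₚ.m*n≢0 2 j

  j≤D : j ℕ.≤ D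
  j≤D = ℕₚ.m≤n*m j 2

  +D≡P : + D ≡ P
  +D≡P = pos-* 2 j

  decompose : ∀ m → m ≡ + (m %ℕ D) + (m /ℕ D) * P
  decompose m = trans (a≡a%ℕn+[a/ℕn]*n m D) (cong (λ p → + (m %ℕ D) + (m /ℕ D) * p) +D≡P)

  C-closed : ∀ q {r} → r ℕ.< D → C j (+ r + q * P) ≡ q * J + + (r ℕ.⊓ j)
  C-closed q {r} r<D = begin
    C j (+ r + q * P)          ≡⟨ cong (λ p → C j (+ r + q * p)) +D≡P ⟨
    ceilSum D j (+ r + q * + D) ≡⟨ ceilSum-closed D q j r<D j≤D ⟩
    J * q + + (r ℕ.⊓ j)        ≡⟨ cong (_+ + (r ℕ.⊓ j)) (*-comm J q) ⟩
    q * J + + (r ℕ.⊓ j)        ∎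

  C-zero : C j 0ℤ ≡ 0ℤ
  C-zero = C-closed 0ℤ (ℕ.>-nonZero⁻¹ D)

  C-periodic : ∀ m b → C j (m + b * P) ≡ C j m + b * J
  C-periodic m b = begin
    C j (m + b * P)               ≡⟨ cong (λ x → C j (x + b * P)) (decompose m) ⟩
    C j (+ r + q * P + b * P)     ≡⟨ cong (C j) (regroup (+ r) q b P) ⟩
    C j (+ r + (q + b) * P)       ≡⟨ C-closed (q + b) r<D ⟩
    (q + b) * J + + (r ℕ.⊓ j)     ≡⟨ distribute q b J (+ (r ℕ.⊓ j)) ⟩
    q * J + + (r ℕ.⊓ j) + b * J   ≡⟨ cong (_+ b * J) (C-closed q r<D) ⟨
    C j (+ r + q * P) + b * J     ≡⟨ cong (λ x → C j x + b * J) (decompose m) ⟨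
    C j m + b * J                 ∎
    where
    r = m %ℕ D
    q = m /ℕ D
    r<D = n%ℕd<d m D
    regroup : ∀ r q b p → r + q * p + b * p ≡ r + (q + b) * p
    regroup = solve-∀
    distribute : ∀ q b j x → (q + b) * j + x ≡ q * j + x + b * j
    distribute = solve-∀

  C-shift : ∀ m → C j (m + P) ≡ C j m + J
  C-shift m = begin
    C j (m + P)          ≡⟨ cong (λ p → C j (m + p)) (*-identityˡ P) ⟨
    C j (m + 1ℤ * P)     ≡⟨ C-periodic m 1ℤ ⟩
    C j m + 1ℤ * J       ≡⟨ cong (_+_ (C j m)) (*-identityˡ J) ⟩
    C j m + J            ∎

  C-complement-below : ∀ q {r} → r ℕ.< j →
    C j (+ r + q * P + J) + C j (+ r + q * P) ≡ + r + q * P + J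
  C-complement-below q {r} r<j = begin
    C j (+ r + q * P + J) + C j (+ r + q * P)       ≡⟨ cong (λ x → C j x + C j (+ r + q * P)) shift ⟩
    C j (+ (r ℕ.+ j) + q * P) + C j (+ r + q * P)   ≡⟨ cong₂ _+_ (C-closed q r+j<D) (C-closed q (ℕₚ.<-≤-trans r<j j≤D)) ⟩
    q * J + + ((r ℕ.+ j) ℕ.⊓ j) + (q * J + + (r ℕ.⊓ j))
      ≡⟨ cong₂ (λ x y → q * J + + x + (q * J + + y)) (ℕₚ.m≥n⇒m⊓n≡n (ℕₚ.m≤n+m j r)) (ℕₚ.m≤n⇒m⊓n≡m (ℕₚ.<⇒≤ r<j)) ⟩
    q * J + J + (q * J + + r)                       ≡⟨ collect q J (+ r) ⟩
    + r + q * P + J                                 ∎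
    where
    reorder : ∀ a b c → a + b + c ≡ a + c + b
    reorder = solve-∀
    shift : + r + q * P + J ≡ + (r ℕ.+ j) + q * P
    shift = trans (reorder (+ r) (q * P) J) (cong (_+ q * P) (sym (pos-+ r j)))
    r+j<D : r ℕ.+ j ℕ.< D
    r+j<D = subst (r ℕ.+ j ℕ.<_) (sym (2*n≡n+n j)) (ℕₚ.+-monoˡ-< j r<j)
    collect : ∀ q j r → q * j + j + (q * j + r) ≡ r + q * (+ 2 * j) + j
    collect = solve-∀

  C-complement-above : ∀ q {r} → j ℕ.≤ r → r ℕ.< D →
    C j (+ r + q * P + J) + C j (+ r + q * P) ≡ + r + q * P + J
  C-complement-above q {r} j≤r r<D = begin
    C j (+ r + q * P + J) + C j (+ r + q * P)         ≡⟨ cong (λ x → C j x + C j (+ r + q * P)) shift ⟩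
    C j (+ e + (q + 1ℤ) * P) + C j (+ r + q * P)      ≡⟨ cong₂ _+_ (C-closed (q + 1ℤ) e<D) (C-closed q r<D) ⟩
    (q + 1ℤ) * J + + (e ℕ.⊓ j) + (q * J + + (r ℕ.⊓ j))
      ≡⟨ cong₂ (λ x y → (q + 1ℤ) * J + + x + (q * J + + y)) (ℕₚ.m≤n⇒m⊓n≡m (ℕₚ.<⇒≤ e<j)) (ℕₚ.m≥n⇒m⊓n≡n j≤r) ⟩
    (q + 1ℤ) * J + + e + (q * J + J)                  ≡⟨ collect q J (+ e) ⟩
    + e + J + q * P + J                               ≡⟨ cong (λ x → x + q * P + J) r≡e+j ⟨
    + r + q * P + J                                   ∎
    where
    e = r ℕ.∸ j
    r≡e+j : + r ≡ + e + J
    r≡e+j = trans (cong +_ (sym (ℕₚ.m∸n+n≡m j≤r))) (pos-+ e j)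
    e<j : e ℕ.< j
    e<j = ℕₚ.m<n+o⇒m∸n<o r j (subst (r ℕ.<_) (2*n≡n+n j) r<D)
    e<D : e ℕ.< D
    e<D = ℕₚ.<-≤-trans e<j j≤D
    regroup : ∀ e q j → e + j + q * (+ 2 * j) + j ≡ e + (q + 1ℤ) * (+ 2 * j)
    regroup = solve-∀
    shift : + r + q * P + J ≡ + e + (q + 1ℤ) * P
    shift = trans (cong (λ x → x + q * P + J) r≡e+j) (regroup (+ e) q J)
    collect : ∀ q j e → (q + 1ℤ) * j + e + (q * j + j) ≡ e + j + q * (+ 2 * j) + j
    collect = solve-∀

  C-complement : ∀ n → C j (n + J) + C j n ≡ n + J
  C-complement n = subst (λ m → C j (m + J) + C j m ≡ m + J) (sym (decompose n))
    (complement (n /ℕ D) (n%ℕd<d n D))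
    where
    complement : ∀ q {r} → r ℕ.< D → C j (+ r + q * P + J) + C j (+ r + q * P) ≡ + r + q * P + J
    complement q {r} r<D with r ℕₚ.<? j
    ... | yes r<j = C-complement-below q r<j
    ... | no  r≮j = C-complement-above q (ℕₚ.≮⇒≥ r≮j) r<D

  C-J : C j J ≡ J
  C-J = begin
    C j J              ≡⟨ +-identityʳ (C j J) ⟨
    C j J + 0ℤ         ≡⟨ cong (_+_ (C j J)) C-zero ⟨
    C j J + C j 0ℤ     ≡⟨ C-complement 0ℤ ⟩
    J                  ∎

  C-reflect : ∀ n → C j (n - J) ≡ n - C j n
  C-reflect n = begin
    C j (n - J)                                  ≡⟨ isolate (C j (n - J)) (C j (n - J + J)) ⟩
    C j (n - J + J) + C j (n - J) - C j (n - J + J) ≡⟨ cong₂ _-_ (C-complement (n - J)) (cong (C j) n-J+J≡n) ⟩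
    n - J + J - C j n                            ≡⟨ cong (_- C j n) n-J+J≡n ⟩
    n - C j n                                    ∎
    where
    isolate : ∀ x y → x ≡ y + x - y
    isolate = solve-∀
    cancel : ∀ n j → n - j + j ≡ n
    cancel = solve-∀
    n-J+J≡n : n - J + J ≡ n
    n-J+J≡n = cancel n J

  C-surjective : ∀ v → ∃ λ n → C j n ≡ v
  C-surjective v = + r + q * P , (begin
    C j (+ r + q * P)     ≡⟨ C-closed q r<D ⟩
    q * J + + (r ℕ.⊓ j)   ≡⟨ cong (λ x → q * J + + x) (ℕₚ.m≤n⇒m⊓n≡m (ℕₚ.<⇒≤ r<j)) ⟩
    q * J + + r           ≡⟨ +-comm (q * J) (+ r) ⟩
    + r + q * J           ≡⟨ a≡a%ℕn+[a/ℕn]*n v j ⟨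
    v                     ∎)
    where
    r = v %ℕ j
    q = v /ℕ j
    r<j : r ℕ.< j
    r<j = n%ℕd<d v j
    r<D : r ℕ.< D
    r<D = ℕₚ.<-≤-trans r<j j≤D

  excess : ℤ → ℕ
  excess m = m %ℕ D ℕ.⊓ (D ℕ.∸ m %ℕ D)

  excess≤j : ∀ m → excess m ℕ.≤ j
  excess≤j m = m⊓[2*n∸m]≤n (m %ℕ D) j

  +excess≡2C-m : ∀ m → + excess m ≡ + 2 * C j m - m
  +excess≡2C-m m = begin
    + excess m                                  ≡⟨ isolate (+ excess m) (+ r) ⟩
    + r + + excess m - + r                      ≡⟨ cong (_- + r) (pos-+ r (excess m)) ⟨
    + (r ℕ.+ excess m) - + r                    ≡⟨ cong (λ x → + x - + r) (m⊓n+m⊓n≡m+m⊓[2*n∸m] (ℕₚ.<⇒≤ (n%ℕd<d m D))) ⟨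
    + (r ℕ.⊓ j ℕ.+ r ℕ.⊓ j) - + r               ≡⟨ cong (_- + r) (pos-+ (r ℕ.⊓ j) (r ℕ.⊓ j)) ⟩
    + (r ℕ.⊓ j) + + (r ℕ.⊓ j) - + r             ≡⟨ double q J (+ (r ℕ.⊓ j)) (+ r) ⟩
    + 2 * (q * J + + (r ℕ.⊓ j)) - (+ r + q * P) ≡⟨ cong (λ c → + 2 * c - (+ r + q * P)) (C-closed q (n%ℕd<d m D)) ⟨
    + 2 * C j (+ r + q * P) - (+ r + q * P)     ≡⟨ cong (λ x → + 2 * C j x - x) (decompose m) ⟨
    + 2 * C j m - m                             ∎
    where
    r = m %ℕ D
    q = m /ℕ D
    isolate : ∀ x y → x ≡ y + x - y
    isolate = solve-∀
    double : ∀ q j x r → x + x - r ≡ + 2 * (q * j + x) - (r + q * (+ 2 * j))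
    double = solve-∀

  excess≡j⇒≡j+2jq : ∀ m → excess m ≡ j → m ≡ J + (m /ℕ D) * P
  excess≡j⇒≡j+2jq m e≡j = trans (decompose m) (cong (λ r → + r + (m /ℕ D) * P) r≡j)
    where
    r≡j : m %ℕ D ≡ j
    r≡j = m⊓[2*n∸m]≡n⇒m≡n (ℕₚ.<⇒≤ (n%ℕd<d m D)) e≡j

  excess[-a]≡j⇒a≡j+2jb : ∀ a → excess (0ℤ - a) ≡ j → ∃ λ b → a ≡ J + b * P
  excess[-a]≡j⇒a≡j+2jb a e≡j = - q - 1ℤ , (begin
    a                ≡⟨ negate-twice a ⟩
    - (0ℤ - a)       ≡⟨ cong -_ (excess≡j⇒≡j+2jq (0ℤ - a) e≡j) ⟩
    - (J + q * P)    ≡⟨ reflect J q ⟩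
    J + (- q - 1ℤ) * P ∎)
    where
    q = (0ℤ - a) /ℕ D
    negate-twice : ∀ a → a ≡ - (0ℤ - a)
    negate-twice = solve-∀
    reflect : ∀ j q → - (j + q * (+ 2 * j)) ≡ j + (- q - 1ℤ) * (+ 2 * j)
    reflect = solve-∀

  2j∣a-j : ∀ {a} b → a ≡ J + b * P → + D ∣ a - J
  2j∣a-j {a} b refl = ∣⇒∣ᵤ (divides b (begin
    J + b * P - J    ≡⟨ cancel J (b * P) ⟩
    b * P            ≡⟨ cong (b *_) +D≡P ⟨
    b * + D          ∎))
    where
    cancel : ∀ j x → j + x - j ≡ x
    cancel = solve-∀

  nested : ℤ → ℤ → ℤ → ℤ
  nested s a n = n - s - C j (n - a)

  nested-shift : ∀ s a n → nested s a (n + P) ≡ nested s a n + J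
  nested-shift s a n = begin
    n + P - s - C j (n + P - a)      ≡⟨ cong (λ m → n + P - s - C j m) (swap n P a) ⟩
    n + P - s - C j (n - a + P)      ≡⟨ cong (_-_ (n + P - s)) (C-shift (n - a)) ⟩
    n + P - s - (C j (n - a) + J)    ≡⟨ collect n s (C j (n - a)) J ⟩
    n - s - C j (n - a) + J          ∎
    where
    swap : ∀ n p a → n + p - a ≡ n - a + p
    swap = solve-∀
    collect : ∀ n s c j → n + + 2 * j - s - (c + j) ≡ n - s - c + j
    collect = solve-∀

  nested-closed : ∀ s {a} b → a ≡ J + b * P → ∀ n → nested s a n ≡ C j n + (b * J - s)
  nested-closed s b refl n = begin
    n - s - C j (n - (J + b * P))     ≡⟨ cong (λ m → n - s - C j m) (regroup n J b P) ⟩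
    n - s - C j (n - J + (- b) * P)   ≡⟨ cong (_-_ (n - s)) (C-periodic (n - J) (- b)) ⟩
    n - s - (C j (n - J) + (- b) * J) ≡⟨ cong (λ c → n - s - (c + (- b) * J)) (C-reflect n) ⟩
    n - s - (n - C j n + (- b) * J)   ≡⟨ collect n s (C j n) b J ⟩
    C j n + (b * J - s)               ∎
    where
    regroup : ∀ n j b p → n - (j + b * p) ≡ n - j + (- b) * p
    regroup = solve-∀
    collect : ∀ n s c b j → n - s - (n - c + (- b) * j) ≡ c + (b * j - s)
    collect = solve-∀

module Solution (j : ℕ) .{{_ : NonZero j}} {s₁ a₁ s₂ a₂ : ℤ}
  (rec : ∀ n → C j n ≡ C j (n - s₁ - C j (n - a₁)) + C j (n - s₂ - C j (n - a₂))) where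

  open C-Properties j

  Δ : ℤ
  Δ = a₁ + a₂ - + 2 * (s₁ + s₂)

  complement-sum : ∀ n → C j n + C j (n + P) ≡ (nested s₁ a₁ n + J) + (nested s₂ a₂ n + J)
  complement-sum n = begin
    C j n + C j (n + P)
      ≡⟨ cong₂ _+_ (rec n) (rec (n + P)) ⟩
    (C j x₁ + C j x₂) + (C j (nested s₁ a₁ (n + P)) + C j (nested s₂ a₂ (n + P)))
      ≡⟨ cong₂ (λ y₁ y₂ → (C j x₁ + C j x₂) + (C j y₁ + C j y₂)) (nested-shift s₁ a₁ n) (nested-shift s₂ a₂ n) ⟩
    (C j x₁ + C j x₂) + (C j (x₁ + J) + C j (x₂ + J))
      ≡⟨ interchange (C j x₁) (C j x₂) (C j (x₁ + J)) (C j (x₂ + J)) ⟩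
    (C j (x₁ + J) + C j x₁) + (C j (x₂ + J) + C j x₂)
      ≡⟨ cong₂ _+_ (C-complement x₁) (C-complement x₂) ⟩
    (x₁ + J) + (x₂ + J)
      ∎
    where
    x₁ = nested s₁ a₁ n
    x₂ = nested s₂ a₂ n
    interchange : ∀ a b c d → (a + b) + (c + d) ≡ (c + a) + (d + b)
    interchange = solve-∀

  key-identity : ∀ n → C j (n - a₁) + C j (n - a₂) ≡ + 2 * n - (s₁ + s₂) + J - + 2 * C j n
  key-identity n = begin
    C j (n - a₁) + C j (n - a₂)
      ≡⟨ isolate (C j (n - a₁)) (C j (n - a₂)) n s₁ s₂ J ⟩
    + 2 * n - (s₁ + s₂) + + 2 * J - ((nested s₁ a₁ n + J) + (nested s₂ a₂ n + J))
      ≡⟨ cong (_-_ (+ 2 * n - (s₁ + s₂) + + 2 * J)) (complement-sum n) ⟨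
    + 2 * n - (s₁ + s₂) + + 2 * J - (C j n + C j (n + P))
      ≡⟨ cong (λ c → + 2 * n - (s₁ + s₂) + + 2 * J - (C j n + c)) (C-shift n) ⟩
    + 2 * n - (s₁ + s₂) + + 2 * J - (C j n + (C j n + J))
      ≡⟨ collect n s₁ s₂ J (C j n) ⟩
    + 2 * n - (s₁ + s₂) + J - + 2 * C j n
      ∎
    where
    isolate : ∀ c₁ c₂ n s₁ s₂ j →
      c₁ + c₂ ≡ + 2 * n - (s₁ + s₂) + + 2 * j - ((n - s₁ - c₁ + j) + (n - s₂ - c₂ + j))
    isolate = solve-∀
    collect : ∀ n s₁ s₂ j c →
      + 2 * n - (s₁ + s₂) + + 2 * j - (c + (c + j)) ≡ + 2 * n - (s₁ + s₂) + j - + 2 * c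
    collect = solve-∀

  excess-identity : ∀ n → + excess (n - a₁) + + excess (n - a₂) ≡ Δ + + 2 * J + + 2 * n - + 4 * C j n
  excess-identity n = begin
    + excess (n - a₁) + + excess (n - a₂)
      ≡⟨ cong₂ _+_ (+excess≡2C-m (n - a₁)) (+excess≡2C-m (n - a₂)) ⟩
    (+ 2 * C j (n - a₁) - (n - a₁)) + (+ 2 * C j (n - a₂) - (n - a₂))
      ≡⟨ gather (C j (n - a₁)) (C j (n - a₂)) n a₁ a₂ ⟩
    + 2 * (C j (n - a₁) + C j (n - a₂)) + (a₁ + a₂) - + 2 * n
      ≡⟨ cong (λ c → + 2 * c + (a₁ + a₂) - + 2 * n) (key-identity n) ⟩
    + 2 * (+ 2 * n - (s₁ + s₂) + J - + 2 * C j n) + (a₁ + a₂) - + 2 * n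
      ≡⟨ collect n s₁ s₂ a₁ a₂ J (C j n) ⟩
    Δ + + 2 * J + + 2 * n - + 4 * C j n
      ∎
    where
    gather : ∀ c₁ c₂ n a₁ a₂ →
      (+ 2 * c₁ - (n - a₁)) + (+ 2 * c₂ - (n - a₂)) ≡ + 2 * (c₁ + c₂) + (a₁ + a₂) - + 2 * n
    gather = solve-∀
    collect : ∀ n s₁ s₂ a₁ a₂ j c →
      + 2 * (+ 2 * n - (s₁ + s₂) + j - + 2 * c) + (a₁ + a₂) - + 2 * n
        ≡ a₁ + a₂ - + 2 * (s₁ + s₂) + + 2 * j + + 2 * n - + 4 * c
    collect = solve-∀

  excess-identity-0 : + excess (0ℤ - a₁) + + excess (0ℤ - a₂) ≡ Δ + + 2 * J
  excess-identity-0 = begin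
    + excess (0ℤ - a₁) + + excess (0ℤ - a₂)   ≡⟨ excess-identity 0ℤ ⟩
    Δ + + 2 * J + + 2 * 0ℤ - + 4 * C j 0ℤ     ≡⟨ cong (λ c → Δ + + 2 * J + + 2 * 0ℤ - + 4 * c) C-zero ⟩
    Δ + + 2 * J + + 2 * 0ℤ - + 4 * 0ℤ         ≡⟨ vanish (Δ + + 2 * J) ⟩
    Δ + + 2 * J                               ∎
    where
    vanish : ∀ x → x + + 2 * 0ℤ - + 4 * 0ℤ ≡ x
    vanish = solve-∀

  excess-identity-j : + excess (J - a₁) + + excess (J - a₂) ≡ Δ
  excess-identity-j = begin
    + excess (J - a₁) + + excess (J - a₂)     ≡⟨ excess-identity J ⟩
    Δ + + 2 * J + + 2 * J - + 4 * C j J       ≡⟨ cong (λ c → Δ + + 2 * J + + 2 * J - + 4 * c) C-J ⟩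
    Δ + + 2 * J + + 2 * J - + 4 * J           ≡⟨ vanish Δ J ⟩
    Δ                                         ∎
    where
    vanish : ∀ x j → x + + 2 * j + + 2 * j - + 4 * j ≡ x
    vanish = solve-∀

  excess[-aᵢ]≡j : excess (0ℤ - a₁) ≡ j × excess (0ℤ - a₂) ≡ j
  excess[-aᵢ]≡j = m≤o⇒n≤o⇒2*o≤m+n⇒m≡o×n≡o (excess≤j (0ℤ - a₁)) (excess≤j (0ℤ - a₂))
    (subst (2 ℕ.* j ℕ.≤_) (sym (+-injective sums)) (ℕₚ.m≤n+m (2 ℕ.* j) (G₁ ℕ.+ G₂)))
    where
    E₁ = excess (0ℤ - a₁)
    E₂ = excess (0ℤ - a₂)
    G₁ = excess (J - a₁)
    G₂ = excess (J - a₂)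
    sums : + (E₁ ℕ.+ E₂) ≡ + (G₁ ℕ.+ G₂ ℕ.+ 2 ℕ.* j)
    sums = begin
      + (E₁ ℕ.+ E₂)                ≡⟨ pos-+ E₁ E₂ ⟩
      + E₁ + + E₂                  ≡⟨ excess-identity-0 ⟩
      Δ + + 2 * J                  ≡⟨ cong₂ _+_ excess-identity-j (pos-* 2 j) ⟨
      + G₁ + + G₂ + + (2 ℕ.* j)    ≡⟨ cong (_+ + (2 ℕ.* j)) (pos-+ G₁ G₂) ⟨
      + (G₁ ℕ.+ G₂) + + (2 ℕ.* j)  ≡⟨ pos-+ (G₁ ℕ.+ G₂) (2 ℕ.* j) ⟨
      + (G₁ ℕ.+ G₂ ℕ.+ 2 ℕ.* j)    ∎

  2[s₁+s₂]≡a₁+a₂ : + 2 * (s₁ + s₂) ≡ a₁ + a₂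
  2[s₁+s₂]≡a₁+a₂ = sym (i-j≡0⇒i≡j (a₁ + a₂) (+ 2 * (s₁ + s₂)) Δ≡0)
    where
    Δ≡0 : Δ ≡ 0ℤ
    Δ≡0 = begin
      Δ                                                  ≡⟨ isolate Δ (+ 2 * J) ⟩
      Δ + + 2 * J - + 2 * J                              ≡⟨ cong (_- + 2 * J) excess-identity-0 ⟨
      + excess (0ℤ - a₁) + + excess (0ℤ - a₂) - + 2 * J  ≡⟨ cong₂ (λ x y → + x + + y - + 2 * J)
                                                              (proj₁ excess[-aᵢ]≡j) (proj₂ excess[-aᵢ]≡j) ⟩
      J + J - + 2 * J                                    ≡⟨ cancel J ⟩
      0ℤ                                                 ∎
      where
      isolate : ∀ x y → x ≡ x + y - y
      isolate = solve-∀
      cancel : ∀ j → j + j - + 2 * j ≡ 0ℤ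
      cancel = solve-∀

  a₁≡j+2jb : ∃ λ b → a₁ ≡ J + b * P
  a₁≡j+2jb = excess[-a]≡j⇒a≡j+2jb a₁ (proj₁ excess[-aᵢ]≡j)

  a₂≡j+2jb : ∃ λ b → a₂ ≡ J + b * P
  a₂≡j+2jb = excess[-a]≡j⇒a≡j+2jb a₂ (proj₂ excess[-aᵢ]≡j)

  module _ (b₁ b₂ : ℤ) (a₁≡ : a₁ ≡ J + b₁ * P) (a₂≡ : a₂ ≡ J + b₂ * P) where

    u₁ u₂ : ℤ
    u₁ = b₁ * J - s₁
    u₂ = b₂ * J - s₂

    C[-u₁+u₂]≡-u₁ : C j (- u₁ + u₂) ≡ - u₁
    C[-u₁+u₂]≡-u₁ = sym (begin
      - u₁                                               ≡⟨ Cn≡-u₁ ⟨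
      C j n                                              ≡⟨ rec n ⟩
      C j (nested s₁ a₁ n) + C j (nested s₂ a₂ n)        ≡⟨ cong₂ (λ x y → C j x + C j y)
                                                              (nested-closed s₁ b₁ a₁≡ n) (nested-closed s₂ b₂ a₂≡ n) ⟩
      C j (C j n + u₁) + C j (C j n + u₂)                ≡⟨ cong (λ c → C j (c + u₁) + C j (c + u₂)) Cn≡-u₁ ⟩
      C j (- u₁ + u₁) + C j (- u₁ + u₂)                  ≡⟨ cong (λ x → C j x + C j (- u₁ + u₂)) (+-inverseˡ u₁) ⟩
      C j 0ℤ + C j (- u₁ + u₂)                           ≡⟨ cong (_+ C j (- u₁ + u₂)) C-zero ⟩
      0ℤ + C j (- u₁ + u₂)                               ≡⟨ +-identityˡ (C j (- u₁ + u₂)) ⟩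
      C j (- u₁ + u₂)                                    ∎)
      where
      n = proj₁ (C-surjective (- u₁))
      Cn≡-u₁ : C j n ≡ - u₁
      Cn≡-u₁ = proj₂ (C-surjective (- u₁))

    excess[-u₁+u₂]≡j : excess (- u₁ + u₂) ≡ j
    excess[-u₁+u₂]≡j = +-injective (*-cancelˡ-≡ (+ 2) (+ excess d) J (begin
      + 2 * + excess d                                    ≡⟨ cong (+ 2 *_) (+excess≡2C-m d) ⟩
      + 2 * (+ 2 * C j d - d)                             ≡⟨ cong (λ c → + 2 * (+ 2 * c - d)) C[-u₁+u₂]≡-u₁ ⟩
      + 2 * (+ 2 * - u₁ - d)                              ≡⟨ expand b₁ b₂ s₁ s₂ J ⟩
      + 2 * (s₁ + s₂) - ((J + b₁ * P) + (J + b₂ * P)) + + 2 * J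
                                                          ≡⟨ cong (λ a → + 2 * (s₁ + s₂) - a + + 2 * J) (cong₂ _+_ a₁≡ a₂≡) ⟨
      + 2 * (s₁ + s₂) - (a₁ + a₂) + + 2 * J               ≡⟨ cong (_+ + 2 * J) (i≡j⇒i-j≡0 2[s₁+s₂]≡a₁+a₂) ⟩
      0ℤ + + 2 * J                                        ≡⟨ +-identityˡ (+ 2 * J) ⟩
      + 2 * J                                             ∎))
      where
      d = - u₁ + u₂
      expand : ∀ b₁ b₂ s₁ s₂ j →
        + 2 * (+ 2 * - (b₁ * j - s₁) - (- (b₁ * j - s₁) + (b₂ * j - s₂)))
          ≡ + 2 * (s₁ + s₂) - ((j + b₁ * (+ 2 * j)) + (j + b₂ * (+ 2 * j))) + + 2 * j
      expand = solve-∀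

    q : ℤ
    q = (- u₁ + u₂) /ℕ D

    -u₁+u₂≡j+2jq : - u₁ + u₂ ≡ J + q * P
    -u₁+u₂≡j+2jq = excess≡j⇒≡j+2jq (- u₁ + u₂) excess[-u₁+u₂]≡j

    -u₁≡j+jq : - u₁ ≡ J + q * J
    -u₁≡j+jq = begin
      - u₁                ≡⟨ C[-u₁+u₂]≡-u₁ ⟨
      C j (- u₁ + u₂)     ≡⟨ cong (C j) -u₁+u₂≡j+2jq ⟩
      C j (J + q * P)     ≡⟨ C-periodic J q ⟩
      C j J + q * J       ≡⟨ cong (_+ q * J) C-J ⟩
      J + q * J           ∎

    s₁≡[b₁+1+q]j : s₁ ≡ (b₁ + 1ℤ + q) * J
    s₁≡[b₁+1+q]j = begin
      s₁                   ≡⟨ isolate s₁ b₁ J ⟩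
      b₁ * J + - u₁        ≡⟨ cong (_+_ (b₁ * J)) -u₁≡j+jq ⟩
      b₁ * J + (J + q * J) ≡⟨ collect b₁ q J ⟩
      (b₁ + 1ℤ + q) * J    ∎
      where
      isolate : ∀ s b j → s ≡ b * j + - (b * j - s)
      isolate = solve-∀
      collect : ∀ b q j → b * j + (j + q * j) ≡ (b + 1ℤ + q) * j
      collect = solve-∀

    s₂≡[b₂-q]j : s₂ ≡ (b₂ - q) * J
    s₂≡[b₂-q]j = begin
      s₂                                 ≡⟨ isolate s₁ s₂ b₁ b₂ J ⟩
      b₂ * J - ((- u₁ + u₂) - - u₁)      ≡⟨ cong₂ (λ x y → b₂ * J - (x - y)) -u₁+u₂≡j+2jq -u₁≡j+jq ⟩
      b₂ * J - (J + q * P - (J + q * J)) ≡⟨ collect b₂ q J ⟩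
      (b₂ - q) * J                       ∎
      where
      isolate : ∀ s₁ s₂ b₁ b₂ j → s₂ ≡ b₂ * j - ((- (b₁ * j - s₁) + (b₂ * j - s₂)) - - (b₁ * j - s₁))
      isolate = solve-∀
      collect : ∀ b q j → b * j - (j + q * (+ 2 * j) - (j + q * j)) ≡ (b - q) * j
      collect = solve-∀

    j∣sᵢ : J ∣ s₁ × J ∣ s₂
    j∣sᵢ = ∣⇒∣ᵤ (divides (b₁ + 1ℤ + q) s₁≡[b₁+1+q]j) , ∣⇒∣ᵤ (divides (b₂ - q) s₂≡[b₂-q]j)

  j∣s₁×j∣s₂ : J ∣ s₁ × J ∣ s₂
  j∣s₁×j∣s₂ = j∣sᵢ (proj₁ a₁≡j+2jb) (proj₁ a₂≡j+2jb) (proj₂ a₁≡j+2jb) (proj₂ a₂≡j+2jb)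

  2j∣aᵢ-j : + D ∣ a₁ - J × + D ∣ a₂ - J
  2j∣aᵢ-j = 2j∣a-j (proj₁ a₁≡j+2jb) (proj₂ a₁≡j+2jb) , 2j∣a-j (proj₁ a₂≡j+2jb) (proj₂ a₂≡j+2jb)

mainTheorem11 : (j : ℕ) → .{{_ : NonZero j}} → (s₁ a₁ s₂ a₂ : ℤ) →
    (∀ (n : ℤ) → C j n ≡ C j (n - s₁ - C j (n - a₁)) + C j (n - s₂ - C j (n - a₂))) →
    ((+ j ∣ s₁) × (+ j ∣ s₂))
    × ((+ (2 ℕ.* j) ∣ (a₁ - + j)) × (+ (2 ℕ.* j) ∣ (a₂ - + j)))
    × (+ 2 * (s₁ + s₂) ≡ a₁ + a₂)
mainTheorem11 j s₁ a₁ s₂ a₂ rec = j∣s₁×j∣s₂ , 2j∣aᵢ-j , 2[s₁+s₂]≡a₁+a₂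
  where open Solution j rec
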